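{- For integers $\nu\ge1$ and $n\ge0$, \[ \sum_{\tau=0}^{\infty}(-1)^\tau p\!\left(n-\frac{(\nu+\tau)(\nu+\tau-1)}{2}\right)=N_\nu(n), \] where $p(x)=0$ for negative integers $x$.
   Context: $p(n)$ is the number of partitions of $n$, with $p(x)=0$ for $x<0$. Definition of $N_\nu(n)$ (for $\nu\ge1$, $n\ge0$): for a partition $\lambda_1\ge\dots\ge\lambda_k$ of $n$, its $\nu$-Durfee rectangle is the largest rectangle of height $t$ and width $t+\nu$ fitting in its Young diagram, i.e. $t$ is the largest integer $0\le t\le k$ with $\lambda_t\ge t+\nu$ ($t=0$ always allowed). $N_\nu(n)$ is the number of partitions of $n$ such that each of $1,2,\dots,\nu-1$ occurs as a part at least once and every part below the $\nu$-Durfee rectangle is strictly less than its width, i.e. $\lambda_i<t+\nu$ for all $i>t$. -}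

module Defs where

open import Data.Nat using (ℕ; zero; suc; _+_; _*_; _∸_; _≤ᵇ_; _<ᵇ_; _≡ᵇ_; _/_)
open import Data.Bool using (Bool; true; false; _∧_; if_then_else_)
open import Data.List using (List; []; _∷_; length; map; concatMap; filter; foldr; drop; upTo; zip; sum)
open import Data.Integer as ℤ using (ℤ; +_; -_)
open import Data.Product using (_,_; _×_; proj₁; proj₂)
open import Relation.Binary.PropositionalEquality using (_≡_)
open import Data.Bool using (T)
open import Relation.Nullary.Decidable using (Dec)
open import Data.Bool.Properties using (T?)
open import Data.Bool.ListAction using (all; any)

-- A partition is represented as a weakly decreasing list of positive parts
-- λ₁ ≥ λ₂ ≥ … ≥ λₖ.

-- gen f n m : all weakly decreasing lists of positive integers, each ≤ m,
-- summing to n (f is a fuel parameter; f ≥ n suffices since each part ≥ 1).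
gen : ℕ → ℕ → ℕ → List (List ℕ)
gen _       zero    _ = [] ∷ []
gen zero    (suc n) _ = []
gen (suc f) (suc n) m =
  concatMap (λ k → map (k ∷_) (gen f (suc n ∸ k) k))
            (filter (λ k → T? ((k ≤ᵇ m) ∧ (k ≤ᵇ suc n))) (map suc (upTo (suc n))))

partitions : ℕ → List (List ℕ)
partitions n = gen n n n

p : ℕ → ℕ
p n = length (partitions n)

pℤ : ℤ → ℕ
pℤ (+ n)      = p n
pℤ ℤ.-[1+ _ ] = 0

indexed : List ℕ → List (ℕ × ℕ)
indexed λs = zip (map suc (upTo (length λs))) λs

-- ν-Durfee rectangle height t: largest t with 0 ≤ t ≤ k and λ_t ≥ t + ν
-- (t = 0 always allowed)
durfee : ℕ → List ℕ → ℕ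
durfee ν λs = foldr (λ it acc → if (proj₁ it + ν ≤ᵇ proj₂ it) ∧ (acc <ᵇ proj₁ it)
                                  then proj₁ it else acc)
                    0 (indexed λs)

hasSmallParts : ℕ → List ℕ → Bool
hasSmallParts ν λs = all (λ j → any (λ x → x ≡ᵇ j) λs) (map suc (upTo (ν ∸ 1)))

belowOK : ℕ → List ℕ → Bool
belowOK ν λs = all (λ x → x <ᵇ durfee ν λs + ν) (drop (durfee ν λs) λs)

isNν : ℕ → List ℕ → Bool
isNν ν λs = hasSmallParts ν λs ∧ belowOK ν λs

N : ℕ → ℕ → ℕ
N ν n = length (filter (λ λs → T? (isNν ν λs)) (partitions n))

tri : ℕ → ℕ
tri m = (m * (m ∸ 1)) / 2

-- the alternating sum, truncated to τ = 0 … n (all later terms vanish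
-- since (ν+τ)(ν+τ-1)/2 ≥ τ > n for τ > n)
altSum : ℕ → ℕ → ℤ
altSum ν n = go (upTo (suc n))
  where
  sign : ℕ → ℤ → ℤ
  sign τ z = if (τ / 2) * 2 ≡ᵇ τ then z else - z
  go : List ℕ → ℤ
  go []      = + 0
  go (τ ∷ τs) = sign τ (+ pℤ (+ n ℤ.- + tri (ν + τ))) ℤ.+ go τs

-- Let H_ν(n) count the partitions of n in which each of 1, …, ν − 1 occurs. Removing one
-- copy of each of these parts gives H_ν(n) = p(n − ν(ν − 1)/2). A partition counted by
-- H_ν but not by N_ν has, right below its ν-Durfee rectangle of height t, a part equal
-- to the width t + ν; adding one to each of the t rows of the rectangle and replacing
-- that part by ν is a bijection onto the partitions counted by N_{ν+1}. Hence
-- p(n − ν(ν − 1)/2) = N_ν(n) + N_{ν+1}(n), and the alternating sum telescopes, starting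
-- from a ν so large that both sides vanish.

module Submission where

open import Defs
open import Data.Nat using (ℕ; _≥_)
open import Data.Integer using (+_)
open import Relation.Binary.PropositionalEquality using (_≡_)

open import Data.Bool using (Bool; true; false; T; _∧_; not; if_then_else_)
open import Data.Bool.ListAction using (all)
open import Data.Bool.Properties using (T?; T-∧; T-not-≡)
open import Data.Empty using (⊥-elim)
open import Data.Integer as ℤ using (ℤ; -_)
import Data.Integer.Properties as ℤP
open import Data.List using (List; []; _∷_; _∷ʳ_; _++_; length; map; filter; foldr; take; drop; zip; upTo; applyUpTo)
open import Data.List.Properties
  using (foldr-cong; foldr-universal; upTo-∷ʳ; map-upTo; length-map; map-∘; map-id; filter-all; ∷-injectiveˡ; ∷-injectiveʳ)
open import Data.List.Membership.Propositional using (_∈_; _∉_)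
open import Data.List.Membership.Propositional.Properties
  using (∈-map⁺; ∈-map⁻; ∈-filter⁺; ∈-filter⁻; ∈-concat⁺′; ∈-concat⁻′; ∈-upTo⁺; ∈-upTo⁻; ∈-++⁺ʳ; ∈-++⁻)
open import Data.List.Membership.Propositional.Properties.WithK using (unique∧set⇒bag)
open import Data.List.Relation.Binary.BagAndSetEquality using (∼bag⇒↭)
open import Data.List.Relation.Binary.Disjoint.Propositional using (Disjoint)
open import Data.List.Relation.Binary.Permutation.Propositional.Properties using (↭-length)
open import Data.List.Relation.Unary.All as All using (All)
import Data.List.Relation.Unary.All.Properties as All
open import Data.List.Relation.Unary.AllPairs as AllPairs using ()
import Data.List.Relation.Unary.AllPairs.Properties as AllPairs
open import Data.List.Relation.Unary.Any as Any using (here; there)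
import Data.List.Relation.Unary.Any.Properties as Any
open import Data.List.Relation.Unary.Unique.Propositional using (Unique)
import Data.List.Relation.Unary.Unique.Propositional.Properties as Unique
open import Data.Nat
  using (zero; suc; pred; _+_; _*_; _∸_; _/_; _≤_; _<_; _≤ᵇ_; _<ᵇ_; _≡ᵇ_; z≤n; s≤s; _≤?_; _≟_; NonZero; >-nonZero⁻¹)
open import Data.Nat.DivMod using (m/n≡1+[m∸n]/n; +-distrib-/-∣ʳ; m*n/n≡m)
open import Data.Nat.Divisibility using (divides)
open import Data.Nat.ListAction using (sum)
open import Data.Nat.ListAction.Properties using (sum-++)
import Data.Nat.Properties as ℕP
open import Algebra.Properties.CommutativeSemigroup ℕP.+-commutativeSemigroup using (x∙yz≈y∙xz)
open import Data.Nat.Solver using (module +-*-Solver)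
open import Data.Product using (∃; _×_; _,_; proj₁; proj₂)
open import Data.Sum using (inj₁; inj₂)
open import Function using (_∘_)
open import Function.Bundles using (Equivalence; _⇔_; mk⇔)
open import Relation.Nullary using (¬_; yes; no)
open import Relation.Nullary.Negation using (contradiction)
open import Relation.Binary.PropositionalEquality using (_≢_; refl; sym; trans; cong; cong₂; subst)
open import Relation.Binary.PropositionalEquality.Properties using (module ≡-Reasoning)

open +-*-Solver using (solve; _:=_; _:+_; _:*_; con)

-- Lists and counting by bijection

T⇒≡true : ∀ {b} → T b → b ≡ true
T⇒≡true {true} _ = refl

¬T⇒≡false : ∀ {b} → ¬ T b → b ≡ false
¬T⇒≡false {true}  ¬t = ⊥-elim (¬t _)
¬T⇒≡false {false} _  = refl

module _ {A : Set} where

  take-length-++ : ∀ (xs ys : List A) → take (length xs) (xs ++ ys) ≡ xs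
  take-length-++ []       ys = refl
  take-length-++ (x ∷ xs) ys = cong (x ∷_) (take-length-++ xs ys)

  drop-length-++ : ∀ (xs ys : List A) → drop (length xs) (xs ++ ys) ≡ ys
  drop-length-++ []       ys = refl
  drop-length-++ (x ∷ xs) ys = drop-length-++ xs ys

∈-sum-≤ : ∀ {k xs} → k ∈ xs → k ≤ sum xs
∈-sum-≤ {xs = x ∷ xs} (here refl) = ℕP.m≤m+n x (sum xs)
∈-sum-≤ {xs = x ∷ xs} (there k∈) = ℕP.≤-trans (∈-sum-≤ k∈) (ℕP.m≤n+m (sum xs) x)

sum-map-suc : ∀ xs → sum (map suc xs) ≡ length xs + sum xs
sum-map-suc []       = refl
sum-map-suc (x ∷ xs) = cong suc (trans (cong (_+_ x) (sum-map-suc xs)) (x∙yz≈y∙xz x (length xs) (sum xs)))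

map-suc-pred : ∀ {xs} → All (1 ≤_) xs → map suc (map pred xs) ≡ xs
map-suc-pred All.[]              = refl
map-suc-pred (s≤s z≤n All.∷ 1≤xs) = cong (_ ∷_) (map-suc-pred 1≤xs)

map-pred-suc : ∀ xs → map pred (map suc xs) ≡ xs
map-pred-suc xs = trans (sym (map-∘ xs)) (map-id xs)

[t+s]+[v+r]≡s+[t+v+r] : ∀ t s v r → (t + s) + (v + r) ≡ s + ((t + v) + r)
[t+s]+[v+r]≡s+[t+v+r] = solve 4 (λ t s v r → (t :+ s) :+ (v :+ r) := s :+ ((t :+ v) :+ r)) refl

module _ {A B : Set} (f : A → B) where

  map⁺-injectiveOn : ∀ {xs} → (∀ {x y} → x ∈ xs → y ∈ xs → f x ≡ f y → x ≡ y) →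
                     Unique xs → Unique (map f xs)
  map⁺-injectiveOn {[]}     inj AllPairs.[] = AllPairs.[]
  map⁺-injectiveOn {x ∷ xs} inj (x∉xs AllPairs.∷ !xs) =
    All.tabulate fx∉ AllPairs.∷ map⁺-injectiveOn (λ x∈ y∈ → inj (there x∈) (there y∈)) !xs
    where
    fx∉ : ∀ {z} → z ∈ map f xs → f x ≢ z
    fx∉ z∈ with y , y∈ , refl ← ∈-map⁻ f z∈ = λ fx≡fy → All.lookup x∉xs y∈ (inj (here refl) (there y∈) fx≡fy)

  length-≡-inverseOn : ∀ (g : B → A) {xs ys} → Unique xs → Unique ys →
    (∀ {x} → x ∈ xs → f x ∈ ys) → (∀ {y} → y ∈ ys → g y ∈ xs) →
    (∀ {x} → x ∈ xs → g (f x) ≡ x) → (∀ {y} → y ∈ ys → f (g y) ≡ y) →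
    length xs ≡ length ys
  length-≡-inverseOn g {xs} {ys} !xs !ys f∈ g∈ gf fg = begin
    length xs          ≡⟨ length-map f xs ⟨
    length (map f xs)  ≡⟨ ↭-length (∼bag⇒↭ (unique∧set⇒bag !fxs !ys (mk⇔ to from))) ⟩
    length ys          ∎
    where
    open ≡-Reasoning
    !fxs : Unique (map f xs)
    !fxs = map⁺-injectiveOn (λ x∈ y∈ fx≡fy → trans (sym (gf x∈)) (trans (cong g fx≡fy) (gf y∈))) !xs
    to : ∀ {z} → z ∈ map f xs → z ∈ ys
    to z∈ with x , x∈ , refl ← ∈-map⁻ f z∈ = f∈ x∈
    from : ∀ {z} → z ∈ ys → z ∈ map f xs
    from z∈ = subst (_∈ map f xs) (fg z∈) (∈-map⁺ f (g∈ z∈))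

length-filter-∧-split : ∀ {A : Set} (a b : A → Bool) xs →
  length (filter (λ x → T? (a x)) xs) ≡
  length (filter (λ x → T? (a x ∧ b x)) xs) + length (filter (λ x → T? (a x ∧ not (b x))) xs)
length-filter-∧-split a b [] = refl
length-filter-∧-split a b (x ∷ xs) with a x | b x
... | true  | true  = cong suc (length-filter-∧-split a b xs)
... | true  | false = trans (cong suc (length-filter-∧-split a b xs)) (sym (ℕP.+-suc _ _))
... | false | _     = length-filter-∧-split a b xs

-- Alternating sums

sign : ℕ → ℤ → ℤ
sign τ z = if (τ / 2) * 2 ≡ᵇ τ then z else - z

sign-2+ : ∀ τ z → sign (2 + τ) z ≡ sign τ z
sign-2+ τ z rewrite m/n≡1+[m∸n]/n {2 + τ} {2} (s≤s (s≤s z≤n)) = refl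

sign-suc : ∀ τ z → sign (suc τ) z ≡ - sign τ z
sign-suc zero    z = refl
sign-suc (suc τ) z = begin
  sign (2 + τ) z     ≡⟨ sign-2+ τ z ⟩
  sign τ z           ≡⟨ ℤP.neg-involutive (sign τ z) ⟨
  - - sign τ z       ≡⟨ cong -_ (sign-suc τ z) ⟨
  - sign (suc τ) z   ∎
  where open ≡-Reasoning

sign-zero : ∀ τ → sign τ (+ 0) ≡ + 0
sign-zero τ with (τ / 2) * 2 ≡ᵇ τ
... | true  = refl
... | false = refl

signedSum : (ℕ → ℤ) → List ℕ → ℤ
signedSum f = foldr (λ τ s → sign τ (f τ) ℤ.+ s) (+ 0)

signedSum-cong : ∀ {f g : ℕ → ℤ} → (∀ τ → f τ ≡ g τ) → ∀ τs → signedSum f τs ≡ signedSum g τs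
signedSum-cong f≗g = foldr-cong (λ τ s → cong (λ z → sign τ z ℤ.+ s) (f≗g τ)) refl

signedSum-∷ʳ : ∀ f τs τ → signedSum f (τs ∷ʳ τ) ≡ signedSum f τs ℤ.+ sign τ (f τ)
signedSum-∷ʳ f []       τ = ℤP.+-comm (sign τ (f τ)) (+ 0)
signedSum-∷ʳ f (x ∷ xs) τ = trans (cong (ℤ._+_ (sign x (f x))) (signedSum-∷ʳ f xs τ))
                                  (sym (ℤP.+-assoc (sign x (f x)) _ _))

signedSum-upTo-suc : ∀ f K → signedSum f (upTo (suc K)) ≡ f 0 ℤ.- signedSum (f ∘ suc) (upTo K)
signedSum-upTo-suc f zero    = refl
signedSum-upTo-suc f (suc K) = begin
  signedSum f (upTo (2 + K))                         ≡⟨ cong (signedSum f) (upTo-∷ʳ (suc K)) ⟨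
  signedSum f (upTo (suc K) ∷ʳ suc K)                ≡⟨ signedSum-∷ʳ f (upTo (suc K)) (suc K) ⟩
  signedSum f (upTo (suc K)) ℤ.+ sign (suc K) (f (suc K))
    ≡⟨ cong₂ ℤ._+_ (signedSum-upTo-suc f K) (sign-suc K (f (suc K))) ⟩
  (f 0 ℤ.- s) ℤ.+ - t                                ≡⟨ ℤP.+-assoc (f 0) (- s) (- t) ⟩
  f 0 ℤ.+ (- s ℤ.+ - t)                              ≡⟨ cong (ℤ._+_ (f 0)) (ℤP.neg-distrib-+ s t) ⟨
  f 0 ℤ.- (s ℤ.+ t)                                  ≡⟨ cong (ℤ._-_ (f 0)) (signedSum-∷ʳ (f ∘ suc) (upTo K) K) ⟨
  f 0 ℤ.- signedSum (f ∘ suc) (upTo K ∷ʳ K)          ≡⟨ cong (λ τs → f 0 ℤ.- signedSum (f ∘ suc) τs) (upTo-∷ʳ K) ⟩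
  f 0 ℤ.- signedSum (f ∘ suc) (upTo (suc K))         ∎
  where
  s t : ℤ
  s = signedSum (f ∘ suc) (upTo K)
  t = sign K (f (suc K))
  open ≡-Reasoning

signedSum-zero : ∀ {f} → (∀ τ → f τ ≡ + 0) → ∀ τs → signedSum f τs ≡ + 0
signedSum-zero f≗0 []       = refl
signedSum-zero f≗0 (τ ∷ τs) =
  cong₂ ℤ._+_ (trans (cong (sign τ) (f≗0 τ)) (sign-zero τ)) (signedSum-zero f≗0 τs)

tri-suc : ∀ m → tri (suc m) ≡ tri m + m
tri-suc m = begin
  suc m * m / 2              ≡⟨ cong (_/ 2) (doubled m) ⟩
  (m * (m ∸ 1) + m * 2) / 2  ≡⟨ +-distrib-/-∣ʳ (m * (m ∸ 1)) (divides m refl) ⟩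
  tri m + m * 2 / 2          ≡⟨ cong (_+_ (tri m)) (m*n/n≡m m 2) ⟩
  tri m + m                  ∎
  where
  open ≡-Reasoning
  doubled : ∀ m → suc m * m ≡ m * (m ∸ 1) + m * 2
  doubled zero    = refl
  doubled (suc j) = solve 1 (λ j → (con 2 :+ j) :* (con 1 :+ j) := (con 1 :+ j) :* j :+ (con 1 :+ j) :* con 2) refl j

tri-≤-+ : ∀ m d → tri m ≤ tri (m + d)
tri-≤-+ m zero    = ℕP.≤-reflexive (cong tri (sym (ℕP.+-identityʳ m)))
tri-≤-+ m (suc d) = begin
  tri m                ≤⟨ tri-≤-+ m d ⟩
  tri (m + d)          ≤⟨ ℕP.m≤m+n (tri (m + d)) (m + d) ⟩
  tri (m + d) + (m + d) ≡⟨ tri-suc (m + d) ⟨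
  tri (suc (m + d))    ≡⟨ cong tri (ℕP.+-suc m d) ⟨
  tri (m + suc d)      ∎
  where open ℕP.≤-Reasoning

m≤tri[1+m] : ∀ m → m ≤ tri (suc m)
m≤tri[1+m] m = ℕP.≤-trans (ℕP.m≤n+m m (tri m)) (ℕP.≤-reflexive (sym (tri-suc m)))

m<tri[2+m] : ∀ m → m < tri (2 + m)
m<tri[2+m] m = ℕP.≤-trans (ℕP.m≤n+m (suc m) (tri (suc m))) (ℕP.≤-reflexive (sym (tri-suc (suc m))))

pDiff : ℕ → ℕ → ℕ
pDiff n m = pℤ (+ n ℤ.- + m)

pDiff-≥ : ∀ {n m} → m ≤ n → pDiff n m ≡ p (n ∸ m)
pDiff-≥ {n} {m} m≤n rewrite ℤP.m-n≡m⊖n n m | ℤP.⊖-≥ m≤n = refl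

pDiff-< : ∀ {n m} → n < m → pDiff n m ≡ 0
pDiff-< {n} {suc m} (s≤s n≤m) rewrite ℤP.m-n≡m⊖n n (suc m) | ℤP.⊖-< (s≤s n≤m) | ℕP.+-∸-assoc 1 n≤m = refl

pDiff-∸ : ∀ {n k} m → k ≤ n → pDiff (n ∸ k) m ≡ pDiff n (m + k)
pDiff-∸ {n} {k} m k≤n = cong pℤ (begin
  + (n ∸ k) ℤ.- + m             ≡⟨ cong (λ i → i ℤ.- + m) n-k ⟨
  (+ n ℤ.- + k) ℤ.- + m         ≡⟨ ℤP.+-assoc (+ n) (- + k) (- + m) ⟩
  + n ℤ.+ (- + k ℤ.+ - + m)     ≡⟨ cong (ℤ._+_ (+ n)) (ℤP.neg-distrib-+ (+ k) (+ m)) ⟨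
  + n ℤ.- (+ k ℤ.+ + m)         ≡⟨ cong (ℤ._-_ (+ n)) (ℤP.pos-+ k m) ⟨
  + n ℤ.- + (k + m)             ≡⟨ cong (λ j → + n ℤ.- + j) (ℕP.+-comm k m) ⟩
  + n ℤ.- + (m + k)             ∎)
  where
  open ≡-Reasoning
  n-k : + n ℤ.- + k ≡ + (n ∸ k)
  n-k = trans (ℤP.m-n≡m⊖n n k) (ℤP.⊖-≥ k≤n)

+[m+n]-+n≡+m : ∀ m n → + (m + n) ℤ.- + n ≡ + m
+[m+n]-+n≡+m m n = begin
  + (m + n) ℤ.- + n  ≡⟨ ℤP.m-n≡m⊖n (m + n) n ⟩
  (m + n) ℤ.⊖ n      ≡⟨ ℤP.⊖-≥ (ℕP.m≤n+m n m) ⟩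
  + (m + n ∸ n)      ≡⟨ cong +_ (ℕP.m+n∸n≡m m n) ⟩
  + m                ∎
  where open ≡-Reasoning

altTerm : ℕ → ℕ → ℕ → ℤ
altTerm ν n τ = + pDiff n (tri (ν + τ))

-- The `_` is the fold local to the definition of `altSum`, which cannot be named;
-- it is solved by the use in `altSum≡signedSum`.
mutual
  altSum-fold≗signedSum : ∀ ν n τs → _ ≡ signedSum (altTerm ν n) τs
  altSum-fold≗signedSum ν n = foldr-universal _ (λ τ s → sign τ (altTerm ν n τ) ℤ.+ s) (+ 0) refl (λ _ _ → refl)

  altSum≡signedSum : ∀ ν n → altSum ν n ≡ signedSum (altTerm ν n) (upTo (suc n))
  altSum≡signedSum ν n with applyUpTo suc n | altTerm ν n 0
  ... | τs | t₀ = cong (ℤ._+_ t₀) (altSum-fold≗signedSum ν n τs)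

altSum-vanishes : ∀ {ν n} → n < tri ν → altSum ν n ≡ + 0
altSum-vanishes {ν} {n} n<tri = trans (altSum≡signedSum ν n) (signedSum-zero term≡0 (upTo (suc n)))
  where
  term≡0 : ∀ τ → altTerm ν n τ ≡ + 0
  term≡0 τ = cong +_ (pDiff-< (ℕP.<-≤-trans n<tri (tri-≤-+ ν τ)))

altSum-recurrence : ∀ ν n .{{_ : NonZero ν}} → altSum ν n ≡ + pDiff n (tri ν) ℤ.- altSum (suc ν) n
altSum-recurrence ν@(suc k) n = begin
  altSum ν n                                                     ≡⟨ altSum≡signedSum ν n ⟩
  signedSum (altTerm ν n) (upTo (suc n))                         ≡⟨ signedSum-upTo-suc (altTerm ν n) n ⟩
  altTerm ν n 0 ℤ.- signedSum (altTerm ν n ∘ suc) (upTo n)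
    ≡⟨ cong₂ ℤ._-_ (cong (λ m → + pDiff n (tri m)) (ℕP.+-identityʳ ν))
                   (signedSum-cong (λ τ → cong (λ m → + pDiff n (tri m)) (ℕP.+-suc ν τ)) (upTo n)) ⟩
  + pDiff n (tri ν) ℤ.- signedSum (altTerm (suc ν) n) (upTo n)   ≡⟨ cong (ℤ._-_ (+ pDiff n (tri ν))) dropLast ⟨
  + pDiff n (tri ν) ℤ.- altSum (suc ν) n                         ∎
  where
  open ≡-Reasoning
  lastTerm≡0 : sign n (altTerm (suc ν) n n) ≡ + 0
  lastTerm≡0 = trans (cong (sign n ∘ +_) (pDiff-< (ℕP.≤-<-trans (ℕP.m≤n+m n k) (m<tri[2+m] (k + n))))) (sign-zero n)
  dropLast : altSum (suc ν) n ≡ signedSum (altTerm (suc ν) n) (upTo n)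
  dropLast = begin
    altSum (suc ν) n                                             ≡⟨ altSum≡signedSum (suc ν) n ⟩
    signedSum (altTerm (suc ν) n) (upTo (suc n))                 ≡⟨ cong (signedSum _) (upTo-∷ʳ n) ⟨
    signedSum (altTerm (suc ν) n) (upTo n ∷ʳ n)                  ≡⟨ signedSum-∷ʳ (altTerm (suc ν) n) (upTo n) n ⟩
    signedSum (altTerm (suc ν) n) (upTo n) ℤ.+ sign n (altTerm (suc ν) n n)
      ≡⟨ cong (ℤ._+_ (signedSum (altTerm (suc ν) n) (upTo n))) lastTerm≡0 ⟩
    signedSum (altTerm (suc ν) n) (upTo n) ℤ.+ + 0               ≡⟨ ℤP.+-identityʳ _ ⟩
    signedSum (altTerm (suc ν) n) (upTo n)                       ∎

-- Partitions as weakly decreasing lists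

data Desc (m : ℕ) : List ℕ → Set where
  []   : Desc m []
  cons : ∀ {k xs} → 1 ≤ k → k ≤ m → Desc k xs → Desc m (k ∷ xs)

Desc-weaken : ∀ {m m′ xs} → m ≤ m′ → Desc m xs → Desc m′ xs
Desc-weaken m≤m′ []              = []
Desc-weaken m≤m′ (cons 1≤k k≤m d) = cons 1≤k (ℕP.≤-trans k≤m m≤m′) d

Desc-sum : ∀ {m xs} → Desc m xs → Desc (sum xs) xs
Desc-sum []                          = []
Desc-sum (cons {k} {xs} 1≤k k≤m d) = cons 1≤k (ℕP.m≤m+n k (sum xs)) d

Desc⇒All≤ : ∀ {b xs} → Desc b xs → All (_≤ b) xs
Desc⇒All≤ []              = All.[]
Desc⇒All≤ (cons _ x≤b d) = x≤b All.∷ All.map (λ y≤x → ℕP.≤-trans y≤x x≤b) (Desc⇒All≤ d)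

Desc-narrow : ∀ {c xs} → Desc (suc c) xs → All (_< suc c) xs → Desc c xs
Desc-narrow []               All.[]      = []
Desc-narrow (cons 1≤x _ d) (x< All.∷ _) = cons 1≤x (ℕP.≤-pred x<) d

∈-Desc-≤ : ∀ {m k xs} → Desc m xs → k ∈ xs → k ≤ m
∈-Desc-≤ (cons _ x≤m _) (here refl) = x≤m
∈-Desc-≤ (cons _ x≤m d) (there k∈) = ℕP.≤-trans (∈-Desc-≤ d k∈) x≤m

lastOr : ℕ → List ℕ → ℕ
lastOr m []       = m
lastOr m (x ∷ xs) = lastOr x xs

lastOr-map : ∀ (f : ℕ → ℕ) m xs → lastOr (f m) (map f xs) ≡ f (lastOr m xs)
lastOr-map f m []       = refl
lastOr-map f m (x ∷ xs) = lastOr-map f x xs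

Desc-++⁺ : ∀ {m xs ys} → Desc m xs → Desc (lastOr m xs) ys → Desc m (xs ++ ys)
Desc-++⁺ []               dys = dys
Desc-++⁺ (cons 1≤x x≤m d) dys = cons 1≤x x≤m (Desc-++⁺ d dys)

Desc-++⁻ : ∀ {m} xs {ys} → Desc m (xs ++ ys) → Desc m xs × Desc (lastOr m xs) ys
Desc-++⁻ []       d                = [] , d
Desc-++⁻ (x ∷ xs) (cons 1≤x x≤m d) = let dxs , dys = Desc-++⁻ xs d in cons 1≤x x≤m dxs , dys

Desc-map-suc : ∀ {m xs} → Desc m xs → Desc (suc m) (map suc xs)
Desc-map-suc []              = []
Desc-map-suc (cons _ x≤m d) = cons (s≤s z≤n) (s≤s x≤m) (Desc-map-suc d)

Desc-map-pred : ∀ {m xs} → Desc m xs → All (1 <_) xs → Desc (pred m) (map pred xs)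
Desc-map-pred []              All.[]                   = []
Desc-map-pred (cons _ x≤m d) (s≤s (s≤s z≤n) All.∷ 1<xs) = cons (s≤s z≤n) (ℕP.pred-mono-≤ x≤m) (Desc-map-pred d 1<xs)

-- The candidate first parts, written exactly as in `gen`.
module _ (n m : ℕ) where

  firstPart? : ℕ → Bool
  firstPart? k = (k ≤ᵇ m) ∧ (k ≤ᵇ suc n)

  firstParts : List ℕ
  firstParts = filter (T? ∘ firstPart?) (map suc (upTo (suc n)))

  ∈-firstParts⁻ : ∀ {k} → k ∈ firstParts → 1 ≤ k × k ≤ m × k ≤ suc n
  ∈-firstParts⁻ k∈ with ∈-filter⁻ (T? ∘ firstPart?) {xs = map suc (upTo (suc n))} k∈
  ... | k∈′ , k≤ with ∈-map⁻ suc k∈′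
  ...   | j , _ , refl with Equivalence.to (T-∧ {suc j ≤ᵇ m}) k≤
  ...     | k≤m , k≤1+n = s≤s z≤n , ℕP.≤ᵇ⇒≤ (suc j) m k≤m , ℕP.≤ᵇ⇒≤ (suc j) (suc n) k≤1+n

  ∈-firstParts⁺ : ∀ {k} → 1 ≤ k → k ≤ m → k ≤ suc n → k ∈ firstParts
  ∈-firstParts⁺ {suc j} _ k≤m k≤1+n =
    ∈-filter⁺ (T? ∘ firstPart?) (∈-map⁺ suc (∈-upTo⁺ k≤1+n))
      (Equivalence.from T-∧ (ℕP.≤⇒≤ᵇ k≤m , ℕP.≤⇒≤ᵇ k≤1+n))

  firstParts-unique : Unique firstParts
  firstParts-unique = Unique.filter⁺ (T? ∘ firstPart?) (Unique.map⁺ ℕP.suc-injective (Unique.upTo⁺ (suc n)))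

extend : ℕ → ℕ → ℕ → List (List ℕ)
extend f n k = map (k ∷_) (gen f (suc n ∸ k) k)

∈-gen⁻ : ∀ f n m {λs} → λs ∈ gen f n m → Desc m λs × sum λs ≡ n
∈-gen⁻ f       zero    m (here refl) = [] , refl
∈-gen⁻ (suc f) (suc n) m λs∈ with ∈-concat⁻′ (map (extend f n) (firstParts n m)) λs∈
... | _ , λs∈xs , xs∈ with ∈-map⁻ (extend f n) xs∈
... | k , k∈ , refl with ∈-map⁻ (k ∷_) λs∈xs
... | μ , μ∈ , refl with ∈-firstParts⁻ n m k∈ | ∈-gen⁻ f (suc n ∸ k) k μ∈
... | 1≤k , k≤m , k≤1+n | dμ , sμ = cons 1≤k k≤m dμ , trans (cong (_+_ k) sμ) (ℕP.m+[n∸m]≡n k≤1+n)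

∈-gen⁺ : ∀ f n m {λs} → Desc m λs → sum λs ≡ n → n ≤ f → λs ∈ gen f n m
∈-gen⁺ f       zero    m []                        refl _ = here refl
∈-gen⁺ f       zero    m (cons {suc _} _ _ _)      ()   _
∈-gen⁺ (suc f) (suc n) m {k ∷ μ} (cons 1≤k k≤m dμ) sλ   (s≤s n≤f) =
  ∈-concat⁺′ (∈-map⁺ (k ∷_) μ∈) (∈-map⁺ (extend f n) (∈-firstParts⁺ n m 1≤k k≤m k≤1+n))
  where
  k≤1+n : k ≤ suc n
  k≤1+n = subst (k ≤_) sλ (ℕP.m≤m+n k (sum μ))
  μ∈ : μ ∈ gen f (suc n ∸ k) k
  μ∈ = ∈-gen⁺ f (suc n ∸ k) k dμ (trans (sym (ℕP.m+n∸m≡n k (sum μ))) (cong (_∸ k) sλ))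
              (ℕP.≤-trans (ℕP.∸-monoʳ-≤ (suc n) 1≤k) n≤f)

gen-unique : ∀ f n m → Unique (gen f n m)
gen-unique f       zero    m = All.[] AllPairs.∷ AllPairs.[]
gen-unique zero    (suc n) m = AllPairs.[]
gen-unique (suc f) (suc n) m = Unique.concat⁺
  (All.map⁺ (All.tabulate (λ {k} _ → Unique.map⁺ ∷-injectiveʳ (gen-unique f (suc n ∸ k) k))))
  (AllPairs.map⁺ (AllPairs.map extend-disjoint (firstParts-unique n m)))
  where
  extend-disjoint : ∀ {k k′} → k ≢ k′ → Disjoint (extend f n k) (extend f n k′)
  extend-disjoint k≢k′ (v∈ , v∈′) with ∈-map⁻ _ v∈ | ∈-map⁻ _ v∈′
  ... | _ , _ , refl | _ , _ , eq = k≢k′ (∷-injectiveˡ eq)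

∈-partitions⁻ : ∀ {n λs} → λs ∈ partitions n → Desc n λs × sum λs ≡ n
∈-partitions⁻ {n} = ∈-gen⁻ n n n

∈-partitions⁺ : ∀ {m n λs} → Desc m λs → sum λs ≡ n → λs ∈ partitions n
∈-partitions⁺ {n = n} d refl = ∈-gen⁺ n n n (Desc-sum d) refl ℕP.≤-refl

partitions-unique : ∀ n → Unique (partitions n)
partitions-unique n = gen-unique n n n

-- Partitions containing 1, …, ν − 1

insert : ℕ → List ℕ → List ℕ
insert k []       = k ∷ []
insert k (x ∷ xs) with x ≤? k
... | yes _ = k ∷ x ∷ xs
... | no  _ = x ∷ insert k xs

remove : ℕ → List ℕ → List ℕ
remove k []       = []
remove k (x ∷ xs) with x ≟ k
... | yes _ = xs
... | no  _ = x ∷ remove k xs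

module _ {k : ℕ} where

  Desc-insert : ∀ {m xs} → 1 ≤ k → k ≤ m → Desc m xs → Desc m (insert k xs)
  Desc-insert 1≤k k≤m [] = cons 1≤k k≤m []
  Desc-insert {xs = x ∷ xs} 1≤k k≤m (cons 1≤x x≤m d) with x ≤? k
  ... | yes x≤k = cons 1≤k k≤m (cons 1≤x x≤k d)
  ... | no  x≰k = cons 1≤x x≤m (Desc-insert 1≤k (ℕP.<⇒≤ (ℕP.≰⇒> x≰k)) d)

  Desc-remove : ∀ {m xs} → Desc m xs → Desc m (remove k xs)
  Desc-remove [] = []
  Desc-remove {xs = x ∷ xs} (cons 1≤x x≤m d) with x ≟ k
  ... | yes _ = Desc-weaken x≤m d
  ... | no  _ = cons 1≤x x≤m (Desc-remove d)

  sum-insert : ∀ xs → sum (insert k xs) ≡ k + sum xs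
  sum-insert []       = refl
  sum-insert (x ∷ xs) with x ≤? k
  ... | yes _ = refl
  ... | no  _ = trans (cong (_+_ x) (sum-insert xs)) (x∙yz≈y∙xz x k (sum xs))

  sum-remove : ∀ {xs} → k ∈ xs → k + sum (remove k xs) ≡ sum xs
  sum-remove {x ∷ xs} k∈ with x ≟ k | k∈
  ... | yes refl | _          = refl
  ... | no  x≢k  | here k≡x   = contradiction (sym k≡x) x≢k
  ... | no  _    | there k∈xs = trans (x∙yz≈y∙xz k x _) (cong (_+_ x) (sum-remove k∈xs))

  ∈-insert-self : ∀ xs → k ∈ insert k xs
  ∈-insert-self []       = here refl
  ∈-insert-self (x ∷ xs) with x ≤? k
  ... | yes _ = here refl
  ... | no  _ = there (∈-insert-self xs)

  ∈-insert⁺ : ∀ {j xs} → j ∈ xs → j ∈ insert k xs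
  ∈-insert⁺ {xs = x ∷ xs} j∈ with x ≤? k | j∈
  ... | yes _ | _          = there j∈
  ... | no  _ | here j≡x   = here j≡x
  ... | no  _ | there j∈xs = there (∈-insert⁺ j∈xs)

  ∈-remove⁺ : ∀ {j xs} → j ≢ k → j ∈ xs → j ∈ remove k xs
  ∈-remove⁺ {xs = x ∷ xs} j≢k j∈ with x ≟ k | j∈
  ... | yes refl | here j≡x   = contradiction j≡x j≢k
  ... | yes refl | there j∈xs = j∈xs
  ... | no  _    | here j≡x   = here j≡x
  ... | no  _    | there j∈xs = there (∈-remove⁺ j≢k j∈xs)

  remove-insert : ∀ xs → remove k (insert k xs) ≡ xs
  remove-insert [] with k ≟ k
  ... | yes _   = refl
  ... | no  k≢k = contradiction refl k≢k
  remove-insert (x ∷ xs) with x ≤? k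
  ... | yes _ with k ≟ k
  ...   | yes _   = refl
  ...   | no  k≢k = contradiction refl k≢k
  remove-insert (x ∷ xs) | no x≰k with x ≟ k
  ...   | yes refl = contradiction ℕP.≤-refl x≰k
  ...   | no  _    = cong (x ∷_) (remove-insert xs)

  insert-head : ∀ {xs} → Desc k xs → insert k xs ≡ k ∷ xs
  insert-head [] = refl
  insert-head {x ∷ xs} (cons _ x≤k _) with x ≤? k
  ... | yes _   = refl
  ... | no  x≰k = contradiction x≤k x≰k

  insert-remove : ∀ {m xs} → Desc m xs → k ∈ xs → insert k (remove k xs) ≡ xs
  insert-remove {xs = x ∷ xs} (cons _ _ d) k∈ with x ≟ k | k∈
  ... | yes refl | _          = insert-head d
  ... | no  x≢k  | here k≡x   = contradiction (sym k≡x) x≢k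
  ... | no  x≢k  | there k∈xs with x ≤? k
  ...   | yes x≤k = contradiction (ℕP.≤-antisym x≤k (∈-Desc-≤ d k∈xs)) x≢k
  ...   | no  _   = cong (x ∷_) (insert-remove d k∈xs)

SmallParts : ℕ → List ℕ → Set
SmallParts ν λs = ∀ {j} → 1 ≤ j → j < ν → j ∈ λs

∈-smallRange⁺ : ∀ {ν j} → 1 ≤ j → j < ν → j ∈ map suc (upTo (ν ∸ 1))
∈-smallRange⁺ {suc ν} {suc j} _ (s≤s j<ν) = ∈-map⁺ suc (∈-upTo⁺ j<ν)

∈-smallRange⁻ : ∀ {ν j} → j ∈ map suc (upTo (ν ∸ 1)) → 1 ≤ j × j < ν
∈-smallRange⁻ {suc ν} j∈ with i , i∈ , refl ← ∈-map⁻ suc j∈ = s≤s z≤n , s≤s (∈-upTo⁻ i∈)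

module _ {ν : ℕ} {λs : List ℕ} where

  hasSmallParts⁻ : T (hasSmallParts ν λs) → SmallParts ν λs
  hasSmallParts⁻ has 1≤j j<ν =
    Any.map (λ {x} x≡ᵇj → sym (ℕP.≡ᵇ⇒≡ x _ x≡ᵇj))
      (Any.any⁻ _ λs (All.lookup (All.all⁺ _ _ has) (∈-smallRange⁺ 1≤j j<ν)))

  hasSmallParts⁺ : SmallParts ν λs → T (hasSmallParts ν λs)
  hasSmallParts⁺ small = All.all⁻ _ (All.tabulate λ j∈ → let 1≤j , j<ν = ∈-smallRange⁻ {ν} j∈ in
    Any.any⁺ _ (Any.map (λ {x} j≡x → ℕP.≡⇒≡ᵇ x _ (sym j≡x)) (small 1≤j j<ν)))

withSmallParts : ℕ → ℕ → List (List ℕ)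
withSmallParts ν n = filter (T? ∘ hasSmallParts ν) (partitions n)

module _ {ν n : ℕ} {λs : List ℕ} where

  ∈-withSmallParts⁻ : λs ∈ withSmallParts ν n → Desc n λs × sum λs ≡ n × SmallParts ν λs
  ∈-withSmallParts⁻ λs∈ with λs∈′ , has ← ∈-filter⁻ (T? ∘ hasSmallParts ν) {xs = partitions n} λs∈
                       with dλ , sλ ← ∈-partitions⁻ λs∈′ = dλ , sλ , hasSmallParts⁻ has

  ∈-withSmallParts⁺ : ∀ {m} → Desc m λs → sum λs ≡ n → SmallParts ν λs → λs ∈ withSmallParts ν n
  ∈-withSmallParts⁺ dλ sλ small = ∈-filter⁺ (T? ∘ hasSmallParts ν) (∈-partitions⁺ dλ sλ) (hasSmallParts⁺ small)

length-withSmallParts-all : ∀ ν n → (∀ λs → T (hasSmallParts ν λs)) → length (withSmallParts ν n) ≡ p n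
length-withSmallParts-all ν n always = cong length (filter-all (T? ∘ hasSmallParts ν) (All.universal always (partitions n)))

length-withSmallParts-shift : ∀ ν n .{{_ : NonZero ν}} → ν ≤ n →
  length (withSmallParts (suc ν) n) ≡ length (withSmallParts ν (n ∸ ν))
length-withSmallParts-shift ν n ν≤n = length-≡-inverseOn (remove ν) (insert ν)
  (Unique.filter⁺ (T? ∘ hasSmallParts (suc ν)) (partitions-unique n))
  (Unique.filter⁺ (T? ∘ hasSmallParts ν) (partitions-unique (n ∸ ν)))
  remove-∈ insert-∈
  (λ λs∈ → let dλ , _ , small = ∈-withSmallParts⁻ {suc ν} {n} λs∈ in insert-remove dλ (small 1≤ν ℕP.≤-refl))
  (λ {μ} _ → remove-insert μ)
  where
  1≤ν : 1 ≤ ν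
  1≤ν = >-nonZero⁻¹ ν
  remove-∈ : ∀ {λs} → λs ∈ withSmallParts (suc ν) n → remove ν λs ∈ withSmallParts ν (n ∸ ν)
  remove-∈ {λs} λs∈ with dλ , sλ , small ← ∈-withSmallParts⁻ λs∈ =
    ∈-withSmallParts⁺ (Desc-remove dλ)
      (trans (sym (ℕP.m+n∸m≡n ν _)) (cong (_∸ ν) (trans (sum-remove (small 1≤ν ℕP.≤-refl)) sλ)))
      (λ 1≤j j<ν → ∈-remove⁺ (ℕP.<⇒≢ j<ν) (small 1≤j (ℕP.m≤n⇒m≤1+n j<ν)))
  insert-∈ : ∀ {μ} → μ ∈ withSmallParts ν (n ∸ ν) → insert ν μ ∈ withSmallParts (suc ν) n
  insert-∈ {μ} μ∈ with dμ , sμ , small ← ∈-withSmallParts⁻ μ∈ =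
    ∈-withSmallParts⁺ (Desc-insert 1≤ν ν≤n (Desc-weaken (ℕP.m∸n≤m n ν) dμ))
      (trans (sum-insert μ) (trans (cong (_+_ ν) sμ) (ℕP.m+[n∸m]≡n ν≤n)))
      small′
    where
    small′ : SmallParts (suc ν) (insert ν μ)
    small′ 1≤j (s≤s j≤ν) with ℕP.m≤n⇒m<n∨m≡n j≤ν
    ... | inj₁ j<ν = ∈-insert⁺ (small 1≤j j<ν)
    ... | inj₂ refl = ∈-insert-self μ

length-withSmallParts-empty : ∀ ν n → n < ν → length (withSmallParts (suc ν) n) ≡ 0
length-withSmallParts-empty ν n n<ν = length-∉ λ λs∈ →
  let _ , sλ , small = ∈-withSmallParts⁻ {suc ν} {n} λs∈
  in ℕP.<⇒≱ n<ν (subst (ν ≤_) sλ (∈-sum-≤ (small (ℕP.≤-<-trans z≤n n<ν) ℕP.≤-refl)))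
  where
  length-∉ : ∀ {xs : List (List ℕ)} → (∀ {x} → x ∉ xs) → length xs ≡ 0
  length-∉ {[]}    _  = refl
  length-∉ {_ ∷ _} ∉xs = ⊥-elim (∉xs (here refl))

length-withSmallParts-step : ∀ ν n .{{_ : NonZero ν}} →
  (∀ m → length (withSmallParts ν m) ≡ pDiff m (tri ν)) →
  length (withSmallParts (suc ν) n) ≡ pDiff n (tri (suc ν))
length-withSmallParts-step ν n count with ν ≤? n
... | yes ν≤n = begin
  length (withSmallParts (suc ν) n)   ≡⟨ length-withSmallParts-shift ν n ν≤n ⟩
  length (withSmallParts ν (n ∸ ν))   ≡⟨ count (n ∸ ν) ⟩
  pDiff (n ∸ ν) (tri ν)               ≡⟨ pDiff-∸ (tri ν) ν≤n ⟩
  pDiff n (tri ν + ν)                 ≡⟨ cong (pDiff n) (tri-suc ν) ⟨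
  pDiff n (tri (suc ν))               ∎
  where open ≡-Reasoning
... | no ν≰n = trans (length-withSmallParts-empty ν n (ℕP.≰⇒> ν≰n))
                     (sym (pDiff-< (ℕP.<-≤-trans (ℕP.≰⇒> ν≰n) (m≤tri[1+m] ν))))

length-withSmallParts : ∀ ν n → length (withSmallParts ν n) ≡ pDiff n (tri ν)
length-withSmallParts zero          n = trans (length-withSmallParts-all 0 n _) (sym (pDiff-≥ {n} z≤n))
length-withSmallParts (suc zero)    n = trans (length-withSmallParts-all 1 n _) (sym (pDiff-≥ {n} z≤n))
length-withSmallParts (suc (suc ν)) n = length-withSmallParts-step (suc ν) n (length-withSmallParts (suc ν))

-- The ν-Durfee rectangle

data DurfeeRows (ν : ℕ) : ℕ → List ℕ → Set where
  []  : ∀ {i} → DurfeeRows ν i []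
  _∷_ : ∀ {i x xs} → suc i + ν ≤ x → DurfeeRows ν (suc i) xs → DurfeeRows ν i (x ∷ xs)

data DurfeeView (ν i : ℕ) : List ℕ → Set where
  rows++below : ∀ top {below} → DurfeeRows ν i top → Desc (i + length top + ν) below →
                DurfeeView ν i (top ++ below)

durfeeView : ∀ ν i {m λs} → Desc m λs → DurfeeView ν i λs
durfeeView ν i [] = rows++below [] [] []
durfeeView ν i {λs = x ∷ xs} (cons 1≤x x≤m d) with suc i + ν ≤? x
... | no  x≱ =
  rows++below [] [] (cons 1≤x (subst (x ≤_) (cong (_+ ν) (sym (ℕP.+-identityʳ i))) (ℕP.≤-pred (ℕP.≰⇒> x≱))) d)
... | yes x≥ with durfeeView ν (suc i) d
...   | rows++below top {below} rows dbelow =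
  rows++below (x ∷ top) (x≥ ∷ rows) (subst (λ k → Desc (k + ν) below) (sym (ℕP.+-suc i (length top))) dbelow)

indexedFrom : ℕ → List ℕ → List (ℕ × ℕ)
indexedFrom i []       = []
indexedFrom i (x ∷ xs) = (suc i , x) ∷ indexedFrom (suc i) xs

indexed≡indexedFrom0 : ∀ xs → indexed xs ≡ indexedFrom 0 xs
indexed≡indexedFrom0 xs = trans (cong (λ is → zip is xs) (map-upTo suc (length xs))) (zip-applyUpTo 0 suc xs λ _ → refl)
  where
  zip-applyUpTo : ∀ i (f : ℕ → ℕ) xs → (∀ j → f j ≡ suc (i + j)) → zip (applyUpTo f (length xs)) xs ≡ indexedFrom i xs
  zip-applyUpTo i f []       f≗ = refl
  zip-applyUpTo i f (x ∷ xs) f≗ = cong₂ _∷_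
    (cong (_, x) (trans (f≗ 0) (cong suc (ℕP.+-identityʳ i))))
    (zip-applyUpTo (suc i) (f ∘ suc) xs (λ j → trans (f≗ (suc j)) (cong suc (ℕP.+-suc i j))))

-- `durfee` with rows numbered from i + 1; the step function is the one in `durfee`.
durfeeFrom : ℕ → ℕ → List ℕ → ℕ
durfeeFrom ν i xs = foldr (λ it acc → if (proj₁ it + ν ≤ᵇ proj₂ it) ∧ (acc <ᵇ proj₁ it) then proj₁ it else acc)
                          0 (indexedFrom i xs)

durfeeFrom-below : ∀ {ν i b xs} → Desc b xs → b ≤ i + ν → durfeeFrom ν i xs ≡ 0
durfeeFrom-below [] _ = refl
durfeeFrom-below {ν} {i} {xs = x ∷ xs} (cons _ x≤b d) b≤
  rewrite durfeeFrom-below {ν} {suc i} d (ℕP.m≤n⇒m≤1+n (ℕP.≤-trans x≤b b≤))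
        | ¬T⇒≡false {suc i + ν ≤ᵇ x} (λ t → ℕP.<⇒≱ (s≤s (ℕP.≤-trans x≤b b≤)) (ℕP.≤ᵇ⇒≤ _ _ t)) = refl

durfeeFrom-rows : ∀ {ν i b x xs below} → DurfeeRows ν i (x ∷ xs) → Desc b below →
  b ≤ i + length (x ∷ xs) + ν → durfeeFrom ν i ((x ∷ xs) ++ below) ≡ i + length (x ∷ xs)
durfeeFrom-rows {ν} {i} {b} {x} {[]} (x≥ ∷ []) d b≤
  rewrite durfeeFrom-below {ν} {suc i} d (subst (λ k → b ≤ k + ν) (ℕP.+-comm i 1) b≤)
        | T⇒≡true (ℕP.≤⇒≤ᵇ x≥) = ℕP.+-comm 1 i
durfeeFrom-rows {ν} {i} {b} {x} {y ∷ ys} (x≥ ∷ rows) d b≤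
  rewrite durfeeFrom-rows rows d (subst (λ k → b ≤ k + ν) (ℕP.+-suc i (length (y ∷ ys))) b≤)
        | T⇒≡true (ℕP.≤⇒≤ᵇ x≥)
        | ¬T⇒≡false {suc i + length (y ∷ ys) <ᵇ suc i} (λ t → ℕP.<⇒≱ (ℕP.<ᵇ⇒< _ _ t) (ℕP.m≤m+n (suc i) _))
  = sym (ℕP.+-suc i (length (y ∷ ys)))

durfee-++ : ∀ {ν b} top {below} → DurfeeRows ν 0 top → Desc b below → b ≤ length top + ν →
  durfee ν (top ++ below) ≡ length top
durfee-++ {ν} {b} top {below} rows d b≤ = trans (cong (foldr _ 0) (indexed≡indexedFrom0 (top ++ below))) (from-rows top rows b≤)
  where
  from-rows : ∀ top → DurfeeRows ν 0 top → b ≤ length top + ν → durfeeFrom ν 0 (top ++ below) ≡ length top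
  from-rows []      []   b≤ = durfeeFrom-below d b≤
  from-rows (_ ∷ _) rows b≤ = durfeeFrom-rows rows d b≤

belowOK≡ : ∀ {ν b} top {below} → DurfeeRows ν 0 top → Desc b below → b ≤ length top + ν →
  belowOK ν (top ++ below) ≡ all (_<ᵇ length top + ν) below
belowOK≡ {ν} top {below} rows d b≤ rewrite durfee-++ top rows d b≤ = cong (all _) (drop-length-++ top below)

belowOK-++ : ∀ {ν b} top {below} → DurfeeRows ν 0 top → Desc b below → b ≤ length top + ν →
  T (belowOK ν (top ++ below)) ⇔ All (_< length top + ν) below
belowOK-++ top {below} rows d b≤ rewrite belowOK≡ top rows d b≤ =
  mk⇔ (All.map (ℕP.<ᵇ⇒< _ _) ∘ All.all⁺ _ below) (All.all⁻ _ ∘ All.map ℕP.<⇒<ᵇ)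

rows-map-suc : ∀ {ν i xs} → DurfeeRows ν i xs → DurfeeRows (suc ν) i (map suc xs)
rows-map-suc []                          = []
rows-map-suc {ν} {i} (_∷_ {x = x} x≥ rows) = s≤s (subst (_≤ x) (sym (ℕP.+-suc i ν)) x≥) ∷ rows-map-suc rows

rows-map-pred : ∀ {ν i xs} → DurfeeRows (suc ν) i xs → DurfeeRows ν i (map pred xs)
rows-map-pred []                  = []
rows-map-pred {ν} {i} (_∷_ {x = x} x≥ rows) = ℕP.pred-mono-≤ (subst (_≤ x) (ℕP.+-suc (suc i) ν) x≥) ∷ rows-map-pred rows

rows⇒All> : ∀ {ν i xs} → DurfeeRows ν i xs → All (i + ν <_) xs
rows⇒All> []          = All.[]
rows⇒All> (x≥ ∷ rows) = x≥ All.∷ All.map (ℕP.<-trans (ℕP.n<1+n _)) (rows⇒All> rows)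

rows-lastOr : ∀ {ν i x xs} m → DurfeeRows ν i (x ∷ xs) → i + length (x ∷ xs) + ν ≤ lastOr m (x ∷ xs)
rows-lastOr {ν} {i} {x} m (x≥ ∷ []) = subst (λ k → k + ν ≤ x) (ℕP.+-comm 1 i) x≥
rows-lastOr {ν} {i} {xs = y ∷ ys} m (_ ∷ rows) =
  subst (λ k → k + ν ≤ lastOr y ys) (sym (ℕP.+-suc i (length (y ∷ ys)))) (rows-lastOr y rows)

∈-++-rows⁻ : ∀ {ν j top ys} → DurfeeRows ν 0 top → j ≤ ν → j ∈ top ++ ys → j ∈ ys
∈-++-rows⁻ {top = top} rows j≤ j∈ with ∈-++⁻ top j∈
... | inj₁ j∈top = contradiction j≤ (ℕP.<⇒≱ (All.lookup (rows⇒All> rows) j∈top))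
... | inj₂ j∈ys  = j∈ys

-- Widening the Durfee rectangle

1≤t+ν : ∀ {ν} .{{_ : NonZero ν}} t → 1 ≤ t + ν
1≤t+ν {ν} t = ℕP.≤-trans (>-nonZero⁻¹ ν) (ℕP.m≤n+m ν t)

excluded : ℕ → ℕ → List (List ℕ)
excluded ν n = filter (λ λs → T? (hasSmallParts ν λs ∧ not (belowOK ν λs))) (partitions n)

counted : ℕ → ℕ → List (List ℕ)
counted ν n = filter (λ λs → T? (isNν ν λs)) (partitions n)

data ExcludedShape (ν n : ℕ) : List ℕ → Set where
  shape : ∀ {m} top rest → DurfeeRows ν 0 top → Desc (length top + ν) rest →
          Desc m (top ++ (length top + ν) ∷ rest) → sum (top ++ (length top + ν) ∷ rest) ≡ n →
          SmallParts ν (top ++ (length top + ν) ∷ rest) → ExcludedShape ν n (top ++ (length top + ν) ∷ rest)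

data CountedShape (ν n : ℕ) : List ℕ → Set where
  shape : ∀ {m} top below → DurfeeRows (suc ν) 0 top → Desc (length top + ν) below →
          Desc m (top ++ below) → sum (top ++ below) ≡ n → SmallParts (suc ν) (top ++ below) →
          CountedShape ν n (top ++ below)

Desc-¬All<⇒head≡ : ∀ {c below} → Desc c below → ¬ All (_< c) below → ∃ λ rest → below ≡ c ∷ rest × Desc c rest
Desc-¬All<⇒head≡ [] ¬all = contradiction All.[] ¬all
Desc-¬All<⇒head≡ {c} (cons {k} 1≤k k≤c d) ¬all with ℕP.m≤n⇒m<n∨m≡n k≤c
... | inj₁ k<c  = contradiction (k<c All.∷ All.map (λ j≤k → ℕP.≤-<-trans j≤k k<c) (Desc⇒All≤ d)) ¬all
... | inj₂ refl = _ , refl , d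

module _ {ν n : ℕ} .{{_ : NonZero ν}} where

  excluded-shape : ∀ {λs} → λs ∈ excluded ν n → ExcludedShape ν n λs
  excluded-shape {λs} λs∈
    with λs∈′ , t ← ∈-filter⁻ (λ λs → T? (hasSmallParts ν λs ∧ not (belowOK ν λs))) {xs = partitions n} λs∈
    with has , notOK ← Equivalence.to (T-∧ {hasSmallParts ν λs}) t
    with dλ , sλ ← ∈-partitions⁻ λs∈′
    with rows++below top rows dbelow ← durfeeView ν 0 dλ
    with rest , refl , drest ← Desc-¬All<⇒head≡ dbelow (λ all< → subst T (Equivalence.to T-not-≡ notOK)
                                                 (Equivalence.from (belowOK-++ top rows dbelow ℕP.≤-refl) all<))
    = shape top rest rows drest dλ sλ (hasSmallParts⁻ has)

  excluded-∈ : ∀ {λs} → ExcludedShape ν n λs → λs ∈ excluded ν n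
  excluded-∈ (shape top rest rows drest dλ sλ small) =
    ∈-filter⁺ (λ λs → T? (hasSmallParts ν λs ∧ not (belowOK ν λs))) (∈-partitions⁺ dλ sλ)
      (Equivalence.from T-∧ (hasSmallParts⁺ small , Equivalence.from T-not-≡ (¬T⇒≡false notOK)))
    where
    notOK : ¬ T (belowOK ν (top ++ (length top + ν) ∷ rest))
    notOK ok with Equivalence.to (belowOK-++ top rows (cons (1≤t+ν (length top)) ℕP.≤-refl drest) ℕP.≤-refl) ok
    ... | w<w All.∷ _ = ℕP.<-irrefl refl w<w

  counted-shape : ∀ {μ} → μ ∈ counted (suc ν) n → CountedShape ν n μ
  counted-shape {μ} μ∈
    with μ∈′ , t ← ∈-filter⁻ (λ λs → T? (isNν (suc ν) λs)) {xs = partitions n} μ∈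
    with has , ok ← Equivalence.to (T-∧ {hasSmallParts (suc ν) μ}) t
    with dμ , sμ ← ∈-partitions⁻ μ∈′
    with rows++below top {below} rows dbelow ← durfeeView (suc ν) 0 dμ
    = shape top below rows
        (Desc-narrow (subst (λ c → Desc c below) w≡ dbelow)
                     (subst (λ c → All (_< c) below) w≡ (Equivalence.to (belowOK-++ top rows dbelow ℕP.≤-refl) ok)))
        dμ sμ (hasSmallParts⁻ has)
    where
    w≡ : length top + suc ν ≡ suc (length top + ν)
    w≡ = ℕP.+-suc (length top) ν

  counted-∈ : ∀ {μ} → CountedShape ν n μ → μ ∈ counted (suc ν) n
  counted-∈ (shape top below rows dbelow dμ sμ small) =
    ∈-filter⁺ (λ λs → T? (isNν (suc ν) λs)) (∈-partitions⁺ dμ sμ)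
      (Equivalence.from T-∧ (hasSmallParts⁺ small , Equivalence.from (belowOK-++ top rows dbelow w≤) below<))
    where
    w≤ : length top + ν ≤ length top + suc ν
    w≤ = ℕP.+-monoʳ-≤ (length top) (ℕP.n≤1+n ν)
    below< : All (_< length top + suc ν) below
    below< = All.map (λ x≤ → ℕP.≤-<-trans x≤ (ℕP.+-monoʳ-< (length top) (ℕP.n<1+n ν))) (Desc⇒All≤ dbelow)

widen : ℕ → List ℕ → List ℕ
widen ν λs = map suc (take (durfee ν λs) λs) ++ insert ν (drop 1 (drop (durfee ν λs) λs))

narrow : ℕ → List ℕ → List ℕ
narrow ν μ = map pred (take (durfee (suc ν) μ) μ) ++ (durfee (suc ν) μ + ν) ∷ remove ν (drop (durfee (suc ν) μ) μ)

module _ {ν : ℕ} .{{_ : NonZero ν}} where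

  widen-shape : ∀ top rest → DurfeeRows ν 0 top → Desc (length top + ν) rest →
    widen ν (top ++ (length top + ν) ∷ rest) ≡ map suc top ++ insert ν rest
  widen-shape top rest rows drest
    rewrite durfee-++ top rows (cons (1≤t+ν (length top)) ℕP.≤-refl drest) ℕP.≤-refl
          | take-length-++ top ((length top + ν) ∷ rest)
          | drop-length-++ top ((length top + ν) ∷ rest) = refl

  narrow-shape : ∀ top below → DurfeeRows (suc ν) 0 top → Desc (length top + ν) below →
    narrow ν (top ++ below) ≡ map pred top ++ (length (map pred top) + ν) ∷ remove ν below
  narrow-shape top below rows dbelow
    rewrite durfee-++ top rows dbelow (ℕP.+-monoʳ-≤ (length top) (ℕP.n≤1+n ν))
          | take-length-++ top below
          | drop-length-++ top below
          | length-map pred top = refl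

  insert-width : ∀ top {rest} → Desc (length top + ν) rest → Desc (length (map suc top) + ν) (insert ν rest)
  insert-width top {rest} drest = subst (λ t → Desc (t + ν) (insert ν rest)) (sym (length-map suc top))
                                        (Desc-insert (>-nonZero⁻¹ ν) (ℕP.m≤n+m ν (length top)) drest)

  remove-width : ∀ top {below} → Desc (length top + ν) below → Desc (length (map pred top) + ν) (remove ν below)
  remove-width top {below} dbelow = subst (λ t → Desc (t + ν) (remove ν below)) (sym (length-map pred top)) (Desc-remove dbelow)

  width∈below : ∀ {top below} → DurfeeRows (suc ν) 0 top → SmallParts (suc ν) (top ++ below) → ν ∈ below
  width∈below rows small = ∈-++-rows⁻ rows (ℕP.n≤1+n ν) (small (>-nonZero⁻¹ ν) (ℕP.n<1+n ν))

  rows⇒All1≤ : ∀ {top} → DurfeeRows (suc ν) 0 top → All (1 ≤_) top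
  rows⇒All1≤ rows = All.map (ℕP.<⇒≤ ∘ ℕP.≤-<-trans (s≤s z≤n)) (rows⇒All> rows)

  widen-Desc : ∀ {m} top {rest} → Desc (length top + ν) rest → Desc m (top ++ (length top + ν) ∷ rest) →
    Desc (suc m) (map suc top ++ insert ν rest)
  widen-Desc {m} top {rest} drest dλ with dtop , cons _ w≤last _ ← Desc-++⁻ top dλ =
    Desc-++⁺ (Desc-map-suc dtop)
      (subst (λ c → Desc c (insert ν rest)) (sym (lastOr-map suc m top))
        (Desc-weaken (ℕP.m≤n⇒m≤1+n w≤last) (Desc-insert (>-nonZero⁻¹ ν) (ℕP.m≤n+m ν (length top)) drest)))

  widen-sum : ∀ top rest → sum (map suc top ++ insert ν rest) ≡ sum (top ++ (length top + ν) ∷ rest)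
  widen-sum top rest = begin
    sum (map suc top ++ insert ν rest)                  ≡⟨ sum-++ (map suc top) (insert ν rest) ⟩
    sum (map suc top) + sum (insert ν rest)             ≡⟨ cong₂ _+_ (sum-map-suc top) (sum-insert rest) ⟩
    (length top + sum top) + (ν + sum rest)             ≡⟨ [t+s]+[v+r]≡s+[t+v+r] (length top) (sum top) ν (sum rest) ⟩
    sum top + ((length top + ν) + sum rest)             ≡⟨ sum-++ top ((length top + ν) ∷ rest) ⟨
    sum (top ++ (length top + ν) ∷ rest)                ∎
    where open ≡-Reasoning

  widen-small : ∀ top rest → DurfeeRows ν 0 top → SmallParts ν (top ++ (length top + ν) ∷ rest) →
    SmallParts (suc ν) (map suc top ++ insert ν rest)
  widen-small top rest rows small 1≤j (s≤s j≤ν) with ℕP.m≤n⇒m<n∨m≡n j≤ν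
  ... | inj₂ refl = ∈-++⁺ʳ (map suc top) (∈-insert-self rest)
  ... | inj₁ j<ν with ∈-++-rows⁻ rows (ℕP.<⇒≤ j<ν) (small 1≤j j<ν)
  ...   | here refl  = contradiction j<ν (ℕP.≤⇒≯ (ℕP.m≤n+m ν (length top)))
  ...   | there j∈   = ∈-++⁺ʳ (map suc top) (∈-insert⁺ j∈)

  narrow-Desc : ∀ {m} top {below} → DurfeeRows (suc ν) 0 top → Desc (length top + ν) below → ν ∈ below →
    Desc m (top ++ below) → Desc m (map pred top ++ (length (map pred top) + ν) ∷ remove ν below)
  narrow-Desc []          rows dbelow ν∈ dμ = cons (>-nonZero⁻¹ ν) (∈-Desc-≤ dμ ν∈) (Desc-remove dbelow)
  narrow-Desc {m} top@(_ ∷ _) {below} rows dbelow ν∈ dμ with dtop , _ ← Desc-++⁻ top dμ =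
    Desc-weaken ℕP.pred[n]≤n
      (Desc-++⁺ (Desc-map-pred dtop (All.map (ℕP.≤-<-trans (s≤s z≤n)) (rows⇒All> rows)))
        (subst (λ c → Desc c (w ∷ remove ν below)) (sym (lastOr-map pred m top))
          (cons (1≤t+ν _) w≤ (remove-width top dbelow))))
    where
    w : ℕ
    w = length (map pred top) + ν
    w≤ : w ≤ pred (lastOr m top)
    w≤ = subst (_≤ pred (lastOr m top)) (trans (cong pred (ℕP.+-suc (length top) ν)) (cong (_+ ν) (sym (length-map pred top))))
               (ℕP.pred-mono-≤ (rows-lastOr m rows))

  narrow-sum : ∀ top below → All (1 ≤_) top → ν ∈ below →
    sum (map pred top ++ (length (map pred top) + ν) ∷ remove ν below) ≡ sum (top ++ below)
  narrow-sum top below 1≤top ν∈ = begin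
    sum (map pred top ++ (t + ν) ∷ remove ν below)      ≡⟨ sum-++ (map pred top) ((t + ν) ∷ remove ν below) ⟩
    sum (map pred top) + ((t + ν) + sum (remove ν below))
      ≡⟨ [t+s]+[v+r]≡s+[t+v+r] t (sum (map pred top)) ν (sum (remove ν below)) ⟨
    (t + sum (map pred top)) + (ν + sum (remove ν below)) ≡⟨ cong₂ _+_ sum-top (sum-remove ν∈) ⟩
    sum top + sum below                                  ≡⟨ sum-++ top below ⟨
    sum (top ++ below)                                   ∎
    where
    open ≡-Reasoning
    t : ℕ
    t = length (map pred top)
    sum-top : t + sum (map pred top) ≡ sum top
    sum-top = trans (sym (sum-map-suc (map pred top))) (cong sum (map-suc-pred 1≤top))

  narrow-small : ∀ top below → DurfeeRows (suc ν) 0 top → SmallParts (suc ν) (top ++ below) →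
    SmallParts ν (map pred top ++ (length (map pred top) + ν) ∷ remove ν below)
  narrow-small top below rows small {j} 1≤j j<ν =
    ∈-++⁺ʳ (map pred top) (there (∈-remove⁺ (ℕP.<⇒≢ j<ν) (∈-++-rows⁻ rows (ℕP.<⇒≤ j<1+ν) (small 1≤j j<1+ν))))
    where
    j<1+ν : j < suc ν
    j<1+ν = ℕP.m<n⇒m<1+n j<ν

module _ {ν n : ℕ} .{{_ : NonZero ν}} where

  widen-∈ : ∀ {λs} → λs ∈ excluded ν n → widen ν λs ∈ counted (suc ν) n
  widen-∈ λs∈ with shape top rest rows drest dλ sλ small ← excluded-shape {ν} {n} λs∈ =
    subst (_∈ counted (suc ν) n) (sym (widen-shape top rest rows drest))
      (counted-∈ {ν} {n} (shape (map suc top) (insert ν rest) (rows-map-suc rows)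
        (insert-width top drest)
        (widen-Desc top drest dλ) (trans (widen-sum top rest) sλ) (widen-small top rest rows small)))

  narrow-∈ : ∀ {μ} → μ ∈ counted (suc ν) n → narrow ν μ ∈ excluded ν n
  narrow-∈ μ∈ with shape top below rows dbelow dμ sμ small ← counted-shape {ν} {n} μ∈ =
    subst (_∈ excluded ν n) (sym (narrow-shape top below rows dbelow))
      (excluded-∈ {ν} {n} (shape (map pred top) (remove ν below) (rows-map-pred rows)
        (remove-width top dbelow)
        (narrow-Desc top rows dbelow ν∈ dμ) (trans (narrow-sum top below 1≤top ν∈) sμ) (narrow-small top below rows small)))
    where
    ν∈ : ν ∈ below
    ν∈ = width∈below rows small
    1≤top : All (1 ≤_) top
    1≤top = rows⇒All1≤ rows

  narrow∘widen : ∀ {λs} → λs ∈ excluded ν n → narrow ν (widen ν λs) ≡ λs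
  narrow∘widen λs∈ with shape top rest rows drest _ _ _ ← excluded-shape {ν} {n} λs∈ = begin
    narrow ν (widen ν (top ++ (length top + ν) ∷ rest))    ≡⟨ cong (narrow ν) (widen-shape top rest rows drest) ⟩
    narrow ν (map suc top ++ insert ν rest)
      ≡⟨ narrow-shape (map suc top) (insert ν rest) (rows-map-suc rows) (insert-width top drest) ⟩
    map pred (map suc top) ++ (length (map pred (map suc top)) + ν) ∷ remove ν (insert ν rest)
      ≡⟨ cong₂ (λ xs ys → xs ++ (length xs + ν) ∷ ys) (map-pred-suc top) (remove-insert rest) ⟩
    top ++ (length top + ν) ∷ rest                          ∎
    where open ≡-Reasoning

  widen∘narrow : ∀ {μ} → μ ∈ counted (suc ν) n → widen ν (narrow ν μ) ≡ μ
  widen∘narrow μ∈ with shape top below rows dbelow _ _ small ← counted-shape {ν} {n} μ∈ = begin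
    widen ν (narrow ν (top ++ below))                       ≡⟨ cong (widen ν) (narrow-shape top below rows dbelow) ⟩
    widen ν (map pred top ++ (length (map pred top) + ν) ∷ remove ν below)
      ≡⟨ widen-shape (map pred top) (remove ν below) (rows-map-pred rows) (remove-width top dbelow) ⟩
    map suc (map pred top) ++ insert ν (remove ν below)
      ≡⟨ cong₂ _++_ (map-suc-pred (rows⇒All1≤ rows)) (insert-remove dbelow (width∈below rows small)) ⟩
    top ++ below                                            ∎
    where open ≡-Reasoning

length-excluded : ∀ ν n .{{_ : NonZero ν}} → length (excluded ν n) ≡ N (suc ν) n
length-excluded ν n = length-≡-inverseOn (widen ν) (narrow ν)
  (Unique.filter⁺ (λ λs → T? (hasSmallParts ν λs ∧ not (belowOK ν λs))) (partitions-unique n))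
  (Unique.filter⁺ (λ λs → T? (isNν (suc ν) λs)) (partitions-unique n))
  (widen-∈ {ν} {n}) (narrow-∈ {ν} {n}) (narrow∘widen {ν} {n}) (widen∘narrow {ν} {n})

pDiff≡N+N : ∀ ν n .{{_ : NonZero ν}} → pDiff n (tri ν) ≡ N ν n + N (suc ν) n
pDiff≡N+N ν n = begin
  pDiff n (tri ν)                      ≡⟨ length-withSmallParts ν n ⟨
  length (withSmallParts ν n) ≡⟨ length-filter-∧-split (hasSmallParts ν) (belowOK ν) (partitions n) ⟩
  N ν n + length (excluded ν n) ≡⟨ cong (_+_ (N ν n)) (length-excluded ν n) ⟩
  N ν n + N (suc ν) n                   ∎
  where open ≡-Reasoning

altSum≡N-small : ∀ ν n .{{_ : NonZero ν}} → n < tri ν → altSum ν n ≡ + N ν n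
altSum≡N-small ν n n<tri = trans (altSum-vanishes n<tri) (cong +_ (sym (ℕP.m+n≡0⇒m≡0 (N ν n) N+N≡0)))
  where
  N+N≡0 : N ν n + N (suc ν) n ≡ 0
  N+N≡0 = trans (sym (pDiff≡N+N ν n)) (pDiff-< n<tri)

altSum≡N-step : ∀ ν n .{{_ : NonZero ν}} → altSum (suc ν) n ≡ + N (suc ν) n → altSum ν n ≡ + N ν n
altSum≡N-step ν n ih = begin
  altSum ν n                                  ≡⟨ altSum-recurrence ν n ⟩
  + pDiff n (tri ν) ℤ.- altSum (suc ν) n      ≡⟨ cong₂ (λ a b → + a ℤ.- b) (pDiff≡N+N ν n) ih ⟩
  + (N ν n + N (suc ν) n) ℤ.- + N (suc ν) n   ≡⟨ +[m+n]-+n≡+m (N ν n) (N (suc ν) n) ⟩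
  + N ν n                                     ∎
  where open ≡-Reasoning

altSum≡N : ∀ d ν n .{{_ : NonZero ν}} → n < tri (ν + d) → altSum ν n ≡ + N ν n
altSum≡N zero    ν n n< = altSum≡N-small ν n (subst (λ m → n < tri m) (ℕP.+-identityʳ ν) n<)
altSum≡N (suc d) ν n n< = altSum≡N-step ν n (altSum≡N d (suc ν) n (subst (λ m → n < tri m) (ℕP.+-suc ν d) n<))

theorem1p10 : (ν n : ℕ) → ν ≥ 1 → altSum ν n ≡ + N ν n
theorem1p10 (suc k) n _ = altSum≡N (suc n) (suc k) n n<tri
  where
  n<tri : n < tri (suc k + suc n)
  n<tri = ℕP.≤-<-trans (ℕP.m≤n+m n k) (subst (λ m → k + n < tri m) (sym (cong suc (ℕP.+-suc k n))) (m<tri[2+m] (k + n)))
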